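{- Let $M_0$ be an $n\times n$ permutation matrix and let $M_0\to M_1\to\cdots\to M_r$ be a percolation sequence. Then for every $0\le t\le r$, every row and every column of $M_t$ contains at least one entry equal to $1$, and the entries equal to $1$ in that row (resp. column) form a single unbroken contiguous string (no $0$ lies between two $1$'s of the same row or column).
   Context: Bootstrap percolation on a $0$-$1$ matrix: a cell is mutable if it contains $0$ and at least two of its (up to four) orthogonal neighbours (north, south, east, west) contain $1$. A percolation step changes one mutable cell from $0$ to $1$. A percolation sequence $M_0\to M_1\to\cdots\to M_r$ is a sequence in which each $M_{t+1}$ is obtained from $M_t$ by one percolation step. -}

module Defs where

open import Data.Nat using (ℕ; suc; _+_; _≤_)
open import Data.Nat.Base using (∣_-_∣)
open import Data.Fin using (Fin; toℕ; inject₁) renaming (suc to fsuc)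
open import Data.Fin.Permutation using (Permutation′; _⟨$⟩ʳ_)
open import Data.Bool using (Bool; true; false)
open import Data.Product using (_×_; ∃-syntax; Σ-syntax)
open import Relation.Binary.PropositionalEquality using (_≡_)
open import Relation.Nullary using (¬_)

-- An n×n 0-1 matrix: entry true = 1, false = 0.
Matrix : ℕ → Set
Matrix n = Fin n → Fin n → Bool

IsPermutationMatrix : ∀ {n} → Matrix n → Set
IsPermutationMatrix {n} M =
  Σ[ π ∈ Permutation′ n ] (∀ i j → (M i j ≡ true → j ≡ π ⟨$⟩ʳ i) × (j ≡ π ⟨$⟩ʳ i → M i j ≡ true))

Adjacent : ∀ {n} → Fin n → Fin n → Fin n → Fin n → Set
Adjacent i j i' j' = ∣ toℕ i - toℕ i' ∣ + ∣ toℕ j - toℕ j' ∣ ≡ 1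

Mutable : ∀ {n} → Matrix n → Fin n → Fin n → Set
Mutable {n} M i j =
  (M i j ≡ false) ×
  (Σ[ a ∈ Fin n ] Σ[ b ∈ Fin n ] Σ[ c ∈ Fin n ] Σ[ d ∈ Fin n ]
     (Adjacent i j a b × Adjacent i j c d × ¬ ((a ≡ c) × (b ≡ d)) ×
      (M a b ≡ true) × (M c d ≡ true)))

Step : ∀ {n} → Matrix n → Matrix n → Set
Step {n} M M' =
  Σ[ i ∈ Fin n ] Σ[ j ∈ Fin n ]
    (Mutable M i j × (M' i j ≡ true) ×
     (∀ k l → ¬ ((k ≡ i) × (l ≡ j)) → M' k l ≡ M k l))

PercolationSequence : ∀ {n} (r : ℕ) → (Fin (suc r) → Matrix n) → Set
PercolationSequence {n} r Ms = ∀ (t : Fin r) → Step (Ms (inject₁ t)) (Ms (fsuc t))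

RowGood : ∀ {n} → Matrix n → Fin n → Set
RowGood {n} M i =
  (∃[ j ] M i j ≡ true) ×
  (∀ j₁ j j₂ → toℕ j₁ ≤ toℕ j → toℕ j ≤ toℕ j₂ →
     M i j₁ ≡ true → M i j₂ ≡ true → M i j ≡ true)

ColGood : ∀ {n} → Matrix n → Fin n → Set
ColGood {n} M j =
  (∃[ i ] M i j ≡ true) ×
  (∀ i₁ i i₂ → toℕ i₁ ≤ toℕ i → toℕ i ≤ toℕ i₂ →
     M i₁ j ≡ true → M i₂ j ≡ true → M i j ≡ true)

{-# OPTIONS --safe #-}
-- The invariant "every row and every column contains a 1 and its 1's are
-- contiguous" holds for a permutation matrix and survives each percolation
-- step.  A mutable cell holds a 0, so its column cannot have 1's directly
-- above and below it; hence one of its two occupied neighbours lies in its own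
-- row, and filling the cell merely extends the block of 1's of that row by one
-- place.  Columns follow by transposing, since transposition maps percolation
-- steps to percolation steps.
module Submission where

open import Defs
open import Data.Nat using (ℕ; suc; _+_; _≤_)
open import Data.Nat.Base using (∣_-_∣)
open import Data.Nat.Properties
  using (≤-trans; ≤-antisym; ≤-pred; ≤∧≢⇒<; n≤1+n; +-comm; suc-injective;
         ∣m-n∣≡0⇒m≡n; ∣-∣-comm; m≤∣m-n∣+n)
open import Data.Fin using (Fin; zero; toℕ; inject₁; _≟_) renaming (suc to fsuc)
open import Data.Fin.Properties using (toℕ-injective)
open import Data.Fin.Permutation using (_⟨$⟩ʳ_; _⟨$⟩ˡ_; inverseˡ; inverseʳ; flip)
open import Data.Bool using (Bool; true)
open import Data.Bool.Properties using (not-¬)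
open import Data.Product using (_×_; _,_; proj₁; proj₂; ∃-syntax; swap)
open import Data.Sum using (_⊎_; inj₁; inj₂)
open import Data.Empty using (⊥-elim)
open import Function using (_∘_)
open import Relation.Nullary using (yes; no)
open import Relation.Binary.PropositionalEquality
  using (_≡_; _≢_; refl; sym; trans; cong; subst)

∣m-n∣≡1⇒n≡1+m⊎m≡1+n : ∀ {m n} → ∣ m - n ∣ ≡ 1 → n ≡ suc m ⊎ m ≡ suc n
∣m-n∣≡1⇒n≡1+m⊎m≡1+n {0}     {n}     eq = inj₁ eq
∣m-n∣≡1⇒n≡1+m⊎m≡1+n {suc m} {0}     eq = inj₂ eq
∣m-n∣≡1⇒n≡1+m⊎m≡1+n {suc m} {suc n} eq with ∣m-n∣≡1⇒n≡1+m⊎m≡1+n {m} {n} eq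
... | inj₁ e = inj₁ (cong suc e)
... | inj₂ e = inj₂ (cong suc e)

∣m-n∣≡1⇒m≤1+n : ∀ {m n} → ∣ m - n ∣ ≡ 1 → m ≤ suc n
∣m-n∣≡1⇒m≤1+n {m} {n} eq = subst (λ d → m ≤ d + n) eq (m≤∣m-n∣+n m n)

1+m≡n⇒m≤n : ∀ {m n} → suc m ≡ n → m ≤ n
1+m≡n⇒m≤n {m} refl = n≤1+n m

Contiguous : ∀ {n} → (Fin n → Bool) → Set
Contiguous v = ∀ j₁ j j₂ → toℕ j₁ ≤ toℕ j → toℕ j ≤ toℕ j₂ → v j₁ ≡ true → v j₂ ≡ true → v j ≡ true

contiguous-single : ∀ {n} {v : Fin n → Bool} {c} → (∀ x → v x ≡ true → x ≡ c) → Contiguous v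
contiguous-single {v = v} only-c j₁ j j₂ j₁≤j j≤j₂ one₁ one₂ =
  subst (λ x → v x ≡ true) j₁≡j one₁
  where
  j₁≡j₂ : j₁ ≡ j₂
  j₁≡j₂ = trans (only-c j₁ one₁) (sym (only-c j₂ one₂))
  j₁≡j : j₁ ≡ j
  j₁≡j = toℕ-injective (≤-antisym j₁≤j (subst (λ x → toℕ j ≤ toℕ x) (sym j₁≡j₂) j≤j₂))

contiguous-cong : ∀ {n} {v w : Fin n → Bool} → (∀ x → v x ≡ w x) → Contiguous v → Contiguous w
contiguous-cong v≗w cv j₁ j j₂ j₁≤j j≤j₂ one₁ one₂ =
  trans (sym (v≗w j)) (cv j₁ j j₂ j₁≤j j≤j₂ (trans (v≗w j₁) one₁) (trans (v≗w j₂) one₂))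

contiguous-between-neighbours : ∀ {n} {v : Fin n → Bool} {j a c} → Contiguous v →
  ∣ toℕ j - toℕ a ∣ ≡ 1 → ∣ toℕ j - toℕ c ∣ ≡ 1 → a ≢ c → v a ≡ true → v c ≡ true → v j ≡ true
contiguous-between-neighbours {j = j} {a} {c} cv near-a near-c a≢c one-a one-c
  with ∣m-n∣≡1⇒n≡1+m⊎m≡1+n near-a | ∣m-n∣≡1⇒n≡1+m⊎m≡1+n near-c
... | inj₁ a≡1+j | inj₁ c≡1+j = ⊥-elim (a≢c (toℕ-injective (trans a≡1+j (sym c≡1+j))))
... | inj₂ j≡1+a | inj₂ j≡1+c = ⊥-elim (a≢c (toℕ-injective (suc-injective (trans (sym j≡1+a) j≡1+c))))
... | inj₁ a≡1+j | inj₂ j≡1+c = cv c j a (1+m≡n⇒m≤n (sym j≡1+c)) (1+m≡n⇒m≤n (sym a≡1+j)) one-c one-a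
... | inj₂ j≡1+a | inj₁ c≡1+j = cv a j c (1+m≡n⇒m≤n (sym j≡1+a)) (1+m≡n⇒m≤n (sym c≡1+j)) one-a one-c

-- An end of the interval sitting at j itself is replaced by the neighbour c,
-- which is never beyond k.
contiguous-extend : ∀ {n} {v w : Fin n → Bool} {j c} → Contiguous v →
  ∣ toℕ j - toℕ c ∣ ≡ 1 → v c ≡ true → w j ≡ true → (∀ x → x ≢ j → w x ≡ v x) → Contiguous w
contiguous-extend {v = v} {j = j} {c} cv near-c one-c one-j w≗v j₁ k j₂ j₁≤k k≤j₂ one₁ one₂
  with k ≟ j
... | yes refl = one-j
... | no k≢j = trans (w≗v k k≢j) (between one-before one-after)
  where
  between : ∃[ y ] toℕ y ≤ toℕ k × v y ≡ true → ∃[ y ] toℕ k ≤ toℕ y × v y ≡ true → v k ≡ true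
  between (y₁ , y₁≤k , one-y₁) (y₂ , k≤y₂ , one-y₂) = cv y₁ k y₂ y₁≤k k≤y₂ one-y₁ one-y₂
  one-before : ∃[ y ] toℕ y ≤ toℕ k × v y ≡ true
  one-before with j₁ ≟ j
  ... | yes refl = c , ≤-trans (∣m-n∣≡1⇒m≤1+n (trans (∣-∣-comm (toℕ c) (toℕ j)) near-c))
                                (≤∧≢⇒< j₁≤k (λ e → k≢j (sym (toℕ-injective e))))
                     , one-c
  ... | no j₁≢j = j₁ , j₁≤k , trans (sym (w≗v j₁ j₁≢j)) one₁
  one-after : ∃[ y ] toℕ k ≤ toℕ y × v y ≡ true
  one-after with j₂ ≟ j
  ... | yes refl = c , ≤-pred (≤-trans (≤∧≢⇒< k≤j₂ (k≢j ∘ toℕ-injective)) (∣m-n∣≡1⇒m≤1+n near-c))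
                     , one-c
  ... | no j₂≢j = j₂ , k≤j₂ , trans (sym (w≗v j₂ j₂≢j)) one₂

transpose : ∀ {n} → Matrix n → Matrix n
transpose M i j = M j i

adjacent-split : ∀ {n} {i j a b : Fin n} → Adjacent i j a b →
  (a ≡ i × ∣ toℕ j - toℕ b ∣ ≡ 1) ⊎ (b ≡ j × ∣ toℕ i - toℕ a ∣ ≡ 1)
adjacent-split {i = i} {j} {a} {b} adj with ∣ toℕ i - toℕ a ∣ in eq
... | 0 = inj₁ (toℕ-injective (sym (∣m-n∣≡0⇒m≡n eq)) , adj)
... | 1 = inj₂ (toℕ-injective (sym (∣m-n∣≡0⇒m≡n (suc-injective adj))) , refl)
... | suc (suc _) with adj
...   | ()

adjacent-transpose : ∀ {n} {i j a b : Fin n} → Adjacent i j a b → Adjacent j i b a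
adjacent-transpose {i = i} {j} {a} {b} adj = trans (+-comm ∣ toℕ j - toℕ b ∣ ∣ toℕ i - toℕ a ∣) adj

-- A mutable cell is 0, so a contiguous column rules out 1's both above and below it.
mutable⇒row-neighbour : ∀ {n} {M : Matrix n} {i j} → Contiguous (transpose M j) → Mutable M i j →
  ∃[ c ] ∣ toℕ j - toℕ c ∣ ≡ 1 × M i c ≡ true
mutable⇒row-neighbour {i = i} {j} col (zero-ij , a , b , c , d , adj₁ , adj₂ , distinct , one₁ , one₂)
  with adjacent-split {i = i} {j} {a} {b} adj₁ | adjacent-split {i = i} {j} {c} {d} adj₂
... | inj₁ (refl , near) | _ = b , near , one₁
... | inj₂ _ | inj₁ (refl , near) = d , near , one₂
... | inj₂ (refl , near₁) | inj₂ (refl , near₂) =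
  ⊥-elim (not-¬ (contiguous-between-neighbours col near₁ near₂ (λ a≡c → distinct (a≡c , refl)) one₁ one₂) zero-ij)

mutable-transpose : ∀ {n} {M : Matrix n} {i j} → Mutable M i j → Mutable (transpose M) j i
mutable-transpose {i = i} {j} (zero-ij , a , b , c , d , adj₁ , adj₂ , distinct , one₁ , one₂) =
  zero-ij , b , a , d , c
  , adjacent-transpose {i = i} {j} {a} {b} adj₁ , adjacent-transpose {i = i} {j} {c} {d} adj₂
  , distinct ∘ swap , one₁ , one₂

step-transpose : ∀ {n} {M M' : Matrix n} → Step M M' → Step (transpose M) (transpose M')
step-transpose (i , j , mutable , one-ij , unchanged) =
  j , i , mutable-transpose mutable , one-ij , λ k l kl≢ji → unchanged l k (kl≢ji ∘ swap)

step-monotone : ∀ {n} {M M' : Matrix n} → Step M M' → ∀ {i j} → M i j ≡ true → M' i j ≡ true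
step-monotone (ci , cj , _ , one-cell , unchanged) {i} {j} one with i ≟ ci | j ≟ cj
... | yes refl | yes refl = one-cell
... | no i≢ci  | _        = trans (unchanged i j (i≢ci ∘ proj₁)) one
... | yes _    | no j≢cj  = trans (unchanged i j (j≢cj ∘ proj₂)) one

step-preserves-rows : ∀ {n} {M M' : Matrix n} → Step M M' →
  (∀ i → RowGood M i) → (∀ j → Contiguous (transpose M j)) → ∀ i → RowGood M' i
step-preserves-rows {M' = M'} s@(ci , cj , mutable , one-cell , unchanged) rows cols i =
  (proj₁ (proj₁ (rows i)) , step-monotone s (proj₂ (proj₁ (rows i)))) , row-contiguous
  where
  row-contiguous : Contiguous (M' i)
  row-contiguous with i ≟ ci | mutable⇒row-neighbour (cols cj) mutable
  ... | yes refl | c , near , one-c =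
    contiguous-extend (proj₂ (rows i)) near one-c one-cell (λ x x≢cj → unchanged i x (x≢cj ∘ proj₂))
  ... | no i≢ci  | _ = contiguous-cong (λ x → sym (unchanged i x (i≢ci ∘ proj₁))) (proj₂ (rows i))

AllLinesGood : ∀ {n} → Matrix n → Set
AllLinesGood M = (∀ i → RowGood M i) × (∀ j → ColGood M j)

-- ColGood M j is RowGood (transpose M) j by definition.
step-preserves-good : ∀ {n} {M M' : Matrix n} → AllLinesGood M → Step M M' → AllLinesGood M'
step-preserves-good (rows , cols) s =
  step-preserves-rows s rows (proj₂ ∘ cols) , step-preserves-rows (step-transpose s) cols (proj₂ ∘ rows)

permutation-transpose : ∀ {n} {M : Matrix n} → IsPermutationMatrix M → IsPermutationMatrix (transpose M)
permutation-transpose (π , graph) = flip π , λ j i →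
    (λ one → trans (sym (inverseˡ π)) (cong (π ⟨$⟩ˡ_) (sym (proj₁ (graph i j) one))))
  , (λ i≡π⁻¹j → proj₂ (graph i j) (trans (sym (inverseʳ π)) (cong (π ⟨$⟩ʳ_) (sym i≡π⁻¹j))))

permutation-rows : ∀ {n} {M : Matrix n} → IsPermutationMatrix M → ∀ i → RowGood M i
permutation-rows (π , graph) i =
  (π ⟨$⟩ʳ i , proj₂ (graph i _) refl) , contiguous-single (λ j → proj₁ (graph i j))

permutation-good : ∀ {n} {M : Matrix n} → IsPermutationMatrix M → AllLinesGood M
permutation-good perm = permutation-rows perm , permutation-rows (permutation-transpose perm)

percolation-invariant : ∀ {n} (P : Matrix n → Set) → (∀ {M M'} → P M → Step M M' → P M') →
  ∀ r (Ms : Fin (suc r) → Matrix n) → P (Ms zero) → PercolationSequence r Ms → ∀ t → P (Ms t)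
percolation-invariant P preserved r       Ms p₀ seq zero     = p₀
percolation-invariant P preserved (suc r) Ms p₀ seq (fsuc t) =
  preserved (percolation-invariant P preserved r (Ms ∘ inject₁) p₀ (seq ∘ inject₁) t) (seq t)

lemma2p10 : (n r : ℕ) (Ms : Fin (suc r) → Matrix n) → IsPermutationMatrix (Ms zero) → PercolationSequence r Ms → (t : Fin (suc r)) → (∀ i → RowGood (Ms t) i) × (∀ j → ColGood (Ms t) j)
lemma2p10 n r Ms perm seq =
  percolation-invariant AllLinesGood step-preserves-good r Ms (permutation-good perm) seq
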